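{- Consider $\mathcal{G}$ as a complete-join-semilattice-enriched $\dagger$-compact closed category with the structure described below. Then $\mathrm{CPM}(\mathbf{Rel})$ and $\mathcal{G}$ are isomorphic as complete-join-semilattice-enriched $\dagger$-compact closed categories.
   Context: $\mathbf{Rel}$: sets and binary relations, dagger the converse relation; a relation $P: X\to X$ is positive if $P=T^\dagger\circ T$ for some relation $T: X\to Y$. $\mathrm{CPM}(\mathbf{Rel})$ has sets as objects; a morphism $A\to B$ is a relation $R\subseteq(A\times A)\times(B\times B)$ such that the relation $\overline{R}$ on $A\times B$, $\overline{R}((a_1,b_1),(a_2,b_2))\iff R(a_2,a_1,b_2,b_1)$, is positive; composition $(S\circ R)(a,a',c,c')\iff\exists b,b'.\ R(a,a',b,b')\wedge S(b,b',c,c')$, identity $1_A(a_1,a_2,a_3,a_4)\iff a_1=a_3\wedge a_2=a_4$. Its structure: tensor on objects is cartesian product and $(R\otimes S)((a,b),(a',b'),(c,d),(c',d'))\iff R(a,a',c,c')\wedge S(b,b',d,d')$ for $R: A\to C$, $S: B\to D$; dagger $R^\dagger(b,b',a,a')\iff R(a,a',b,b')$; symmetry, unit, cups and caps are the images $h\otimes h$ of those of $\mathbf{Rel}$ (cartesian product, self-dual objects with cup $\{(*,(a,a))\}$) under $h\mapsto h\otimes h$; homsets ordered by inclusion of relations (complete join semilattices, joins = unions). A graph is a vertex set $W$ with a set $E$ of unordered pairs $\{v,w\}$ of vertices ($v=w$ allowed) with $\{v\}\in E$ for every $v\in W$; write $V(\gamma),E(\gamma)$. The category $\mathcal{G}$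 has sets as objects; a morphism $\gamma: A\to B$ is a graph with vertex set a subset of $A\times B$; composition: $V(\gamma'\circ\gamma)=\{(a,c)\mid\exists b.\ (a,b)\in V(\gamma)\wedge(b,c)\in V(\gamma')\}$, $E(\gamma'\circ\gamma)=\{\{(a,c),(a',c')\}\mid\exists b,b'.\ \{(a,b),(a',b')\}\in E(\gamma)\wedge\{(b,c),(b',c')\}\in E(\gamma')\}$; identity $1_A$ is the complete graph on $\{(a,a)\mid a\in A\}$. Tensor: on objects cartesian product; for $\gamma: A\to C$, $\gamma': B\to D$, $\gamma\otimes\gamma': A\times B\to C\times D$ has vertices $\{(a,b,c,d)\mid (a,c)\in V(\gamma)\wedge(b,d)\in V(\gamma')\}$ and edges $\{\{(a,b,c,d),(a',b',c',d')\}\mid \{(a,c),(a',c')\}\in E(\gamma)\wedge\{(b,d),(b',d')\}\in E(\gamma')\}$. Order: $\gamma\le\gamma'\iff E(\gamma)\subseteq E(\gamma')$, with joins given by unions of vertex and edge sets. Dagger: identity on objects, $V(\gamma^\dagger)=\{(b,a)\mid(a,b)\in V(\gamma)\}$, $E(\gamma^\dagger)=\{\{(b,a),(b',a')\}\mid\{(a,b),(a',b')\}\in E(\gamma)\}$. Symmetry $A\otimes B\to B\otimes A$: complete graph on $\{((a,b),(b,a))\mid a\in A,b\in B\}$. Cup $\{*\}\to A\otimes A$: complete graph on $\{(*,(a,a))\mid a\in A\}$; cap is its dagger; every object is self-dual. -}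

module Defs where

open import Level using (Level; _⊔_) renaming (suc to lsuc; zero to lzero)
open import Data.Unit using (⊤; tt)
open import Data.Product using (Σ; ∃; _×_; _,_; proj₁; proj₂; swap)
open import Relation.Binary.PropositionalEquality using (_≡_; refl)
open import Function.Bundles using (_⇔_)

-- Sets are Agda types in Set; relations are Set-valued (proof-relevant),
-- compared up to logical equivalence (_⇔_).

fun : {A B : Set} → (A → B) → A → B → Set
fun f a b = f a ≡ b

cupRel : {A : Set} → ⊤ → A × A → Set
cupRel _ (a₁ , a₂) = a₁ ≡ a₂

assocF : {A B C : Set} → (A × B) × C → A × (B × C)
assocF ((a , b) , c) = a , (b , c)

lunitF : {A : Set} → ⊤ × A → A
lunitF (_ , a) = a

runitF : {A : Set} → A × ⊤ → A
runitF (a , _) = a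

-- a relation R ⊆ (A×A)×(B×B); R a a' b b' means ((a,a'),(b,b')) ∈ R
Rel4 : Set → Set → Set₁
Rel4 A B = A → A → B → B → Set

IsPositive : {X : Set} → (X → X → Set) → Set₁
IsPositive {X} P =
  Σ Set λ Y → Σ (X → Y → Set) λ T →
    ∀ x x' → P x x' ⇔ (∃ λ (y : Y) → T x y × T x' y)

bar : {A B : Set} → Rel4 A B → A × B → A × B → Set
bar R (a₁ , b₁) (a₂ , b₂) = R a₂ a₁ b₂ b₁

CPMHom : Set → Set → Set₁
CPMHom A B = Σ (Rel4 A B) λ R → IsPositive (bar R)

_≈C_ : {A B : Set} → Rel4 A B → Rel4 A B → Set
R ≈C S = ∀ a a' b b' → R a a' b b' ⇔ S a a' b b'

_⊆C_ : {A B : Set} → Rel4 A B → Rel4 A B → Set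
R ⊆C S = ∀ a a' b b' → R a a' b b' → S a a' b b'

idC : (A : Set) → Rel4 A A
idC A a₁ a₂ a₃ a₄ = (a₁ ≡ a₃) × (a₂ ≡ a₄)

compC : {A B C : Set} → Rel4 B C → Rel4 A B → Rel4 A C
compC {B = B} S R a a' c c' = ∃ λ (b : B) → ∃ λ (b' : B) → R a a' b b' × S b b' c c'

tensorC : {A B C D : Set} → Rel4 A C → Rel4 B D → Rel4 (A × B) (C × D)
tensorC R S (a , b) (a' , b') (c , d) (c' , d') = R a a' c c' × S b b' d d'

daggerC : {A B : Set} → Rel4 A B → Rel4 B A
daggerC R b b' a a' = R a a' b b'

joinC : {A B : Set} {I : Set} → (I → Rel4 A B) → Rel4 A B
joinC {I = I} R a a' b b' = ∃ λ (i : I) → R i a a' b b'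

-- image h ⊗ h of a relation h : A → B of Rel
liftC : {A B : Set} → (A → B → Set) → Rel4 A B
liftC h a a' b b' = h a b × h a' b'

symC : (A B : Set) → Rel4 (A × B) (B × A)
symC A B = liftC (fun swap)

assocC : (A B C : Set) → Rel4 ((A × B) × C) (A × (B × C))
assocC A B C = liftC (fun assocF)

lunitC : (A : Set) → Rel4 (⊤ × A) A
lunitC A = liftC (fun lunitF)

runitC : (A : Set) → Rel4 (A × ⊤) A
runitC A = liftC (fun runitF)

cupC : (A : Set) → Rel4 ⊤ (A × A)
cupC A = liftC cupRel

capC : (A : Set) → Rel4 (A × A) ⊤
capC A = daggerC (cupC A)

-- A morphism A → B is a graph whose vertex set V is a
-- subset of A × B; the set of unordered edges {(a,b),(a',b')} is encoded
-- as a symmetric relation E, and E a b a' b' means {(a,b),(a',b')} ∈ E.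

record GHom (A B : Set) : Set₁ where
  field
    V     : A → B → Set
    E     : A → B → A → B → Set
    E-sym : ∀ {a b a' b'} → E a b a' b' → E a' b' a b
    E-V   : ∀ {a b a' b'} → E a b a' b' → V a b
    V-E   : ∀ {a b} → V a b → E a b a b
open GHom public

_≈G_ : {A B : Set} → GHom A B → GHom A B → Set
γ ≈G δ = (∀ a b → V γ a b ⇔ V δ a b) × (∀ a b a' b' → E γ a b a' b' ⇔ E δ a b a' b')

_≤G_ : {A B : Set} → GHom A B → GHom A B → Set
γ ≤G δ = ∀ a b a' b' → E γ a b a' b' → E δ a b a' b'

complete : {A B : Set} → (A → B → Set) → GHom A B
complete P = record
  { V = P
  ; E = λ a b a' b' → P a b × P a' b'
  ; E-sym = swap
  ; E-V = proj₁
  ; V-E = λ p → p , p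
  }

idG : (A : Set) → GHom A A
idG A = complete (λ a a' → a ≡ a')

compG : {A B C : Set} → GHom B C → GHom A B → GHom A C
compG {B = B} γ' γ = record
  { V = λ a c → ∃ λ (b : B) → V γ a b × V γ' b c
  ; E = λ a c a' c' → ∃ λ (b : B) → ∃ λ (b' : B) → E γ a b a' b' × E γ' b c b' c'
  ; E-sym = λ { (b , b' , e , e') → b' , b , E-sym γ e , E-sym γ' e' }
  ; E-V = λ { (b , b' , e , e') → b , E-V γ e , E-V γ' e' }
  ; V-E = λ { (b , v , v') → b , b , V-E γ v , V-E γ' v' }
  }

tensorG : {A B C D : Set} → GHom A C → GHom B D → GHom (A × B) (C × D)
tensorG γ γ' = record
  { V = λ { (a , b) (c , d) → V γ a c × V γ' b d }
  ; E = λ { (a , b) (c , d) (a' , b') (c' , d') → E γ a c a' c' × E γ' b d b' d' }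
  ; E-sym = λ { {_ , _} {_ , _} {_ , _} {_ , _} (e , e') → E-sym γ e , E-sym γ' e' }
  ; E-V = λ { {_ , _} {_ , _} {_ , _} {_ , _} (e , e') → E-V γ e , E-V γ' e' }
  ; V-E = λ { {_ , _} {_ , _} (v , v') → V-E γ v , V-E γ' v' }
  }

daggerG : {A B : Set} → GHom A B → GHom B A
daggerG γ = record
  { V = λ b a → V γ a b
  ; E = λ b a b' a' → E γ a b a' b'
  ; E-sym = E-sym γ
  ; E-V = E-V γ
  ; V-E = V-E γ
  }

joinG : {A B : Set} {I : Set} → (I → GHom A B) → GHom A B
joinG {I = I} γ = record
  { V = λ a b → ∃ λ (i : I) → V (γ i) a b
  ; E = λ a b a' b' → ∃ λ (i : I) → E (γ i) a b a' b'
  ; E-sym = λ { (i , e) → i , E-sym (γ i) e }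
  ; E-V = λ { (i , e) → i , E-V (γ i) e }
  ; V-E = λ { (i , v) → i , V-E (γ i) v }
  }

symG : (A B : Set) → GHom (A × B) (B × A)
symG A B = complete (fun swap)

assocG : (A B C : Set) → GHom ((A × B) × C) (A × (B × C))
assocG A B C = complete (fun assocF)

lunitG : (A : Set) → GHom (⊤ × A) A
lunitG A = complete (fun lunitF)

runitG : (A : Set) → GHom (A × ⊤) A
runitG A = complete (fun runitF)

cupG : (A : Set) → GHom ⊤ (A × A)
cupG A = complete cupRel

capG : (A : Set) → GHom (A × A) ⊤
capG A = daggerG (cupG A)

-- An identity-on-objects isomorphism 𝒢 ≅ CPM(Rel) of
-- complete-join-semilattice-enriched †-compact closed categories:
-- Φ : 𝒢 → CPM(Rel) with inverse Ψ (on each homset), where Φ preserves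
-- identities, composition, tensor, dagger, symmetry, associator,
-- unitors, cups, caps, the order (both ways) and arbitrary joins.
-- (Ψ is then automatically a structure-preserving functor as well.)

record IsStructIso
  (Φ : ∀ {A B : Set} → GHom A B → CPMHom A B)
  (Ψ : ∀ {A B : Set} → CPMHom A B → GHom A B) : Set₂ where
  field
    Φ-cong : ∀ {A B} {γ δ : GHom A B} → γ ≈G δ → proj₁ (Φ γ) ≈C proj₁ (Φ δ)
    Ψ-cong : ∀ {A B} {R S : CPMHom A B} → proj₁ R ≈C proj₁ S → Ψ R ≈G Ψ S
    ΦΨ     : ∀ {A B} (R : CPMHom A B) → proj₁ (Φ (Ψ R)) ≈C proj₁ R
    ΨΦ     : ∀ {A B} (γ : GHom A B) → Ψ (Φ γ) ≈G γ
    Φ-id   : ∀ (A : Set) → proj₁ (Φ (idG A)) ≈C idC A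
    Φ-comp : ∀ {A B C} (γ' : GHom B C) (γ : GHom A B) →
               proj₁ (Φ (compG γ' γ)) ≈C compC (proj₁ (Φ γ')) (proj₁ (Φ γ))
    Φ-tensor : ∀ {A B C D} (γ : GHom A C) (γ' : GHom B D) →
               proj₁ (Φ (tensorG γ γ')) ≈C tensorC (proj₁ (Φ γ)) (proj₁ (Φ γ'))
    Φ-dagger : ∀ {A B} (γ : GHom A B) → proj₁ (Φ (daggerG γ)) ≈C daggerC (proj₁ (Φ γ))
    Φ-sym    : ∀ (A B : Set) → proj₁ (Φ (symG A B)) ≈C symC A B
    Φ-assoc  : ∀ (A B C : Set) → proj₁ (Φ (assocG A B C)) ≈C assocC A B C
    Φ-lunit  : ∀ (A : Set) → proj₁ (Φ (lunitG A)) ≈C lunitC A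
    Φ-runit  : ∀ (A : Set) → proj₁ (Φ (runitG A)) ≈C runitC A
    Φ-cup    : ∀ (A : Set) → proj₁ (Φ (cupG A)) ≈C cupC A
    Φ-cap    : ∀ (A : Set) → proj₁ (Φ (capG A)) ≈C capC A
    Φ-order  : ∀ {A B} (γ δ : GHom A B) → (γ ≤G δ → proj₁ (Φ γ) ⊆C proj₁ (Φ δ))
                                         × (proj₁ (Φ γ) ⊆C proj₁ (Φ δ) → γ ≤G δ)
    Φ-join   : ∀ {A B} {I : Set} (γ : I → GHom A B) →
               proj₁ (Φ (joinG γ)) ≈C joinC (λ i → proj₁ (Φ (γ i)))

module Submission where

-- The edge set of γ, read as R a a' b b' = E γ a b a' b',
-- is a relation on A × B that is symmetric and closed under passing from
-- an edge to its endpoint loops; conversely such a relation is a graph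
-- whose vertices are its loops.  The key fact is the characterisation
-- that a relation P on X is positive in Rel exactly when it has these
-- two closure properties, and then P factors as T† ∘ T through the incidence
-- relation T between points and the "edges" of P.
--
-- They are mutually inverse because a
-- vertex of a graph is the same as a loop at it.  All structure (identity,
-- composition, tensor, dagger, symmetry, associator, unitors, cups, caps,
-- order and joins) is defined on both sides by the same formula on edges,
-- so Φ preserves it on the nose: each law is an instance of reflexivity.

open import Defs
open import Data.Product using (Σ; ∃; _×_; _,_)
open import Data.Sum using (inj₁; inj₂; _⊎_)
open import Relation.Binary.PropositionalEquality using (_≡_; refl)
open import Function.Bundles using (_⇔_; mk⇔; module Equivalence)
open import Function.Construct.Identity using (⇔-id)

record IsGraphRel {X : Set} (P : X → X → Set) : Set where
  field
    sym  : ∀ {x x'} → P x x' → P x' x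
    loop : ∀ {x x'} → P x x' → P x x

positive⇒graphRel : {X : Set} {P : X → X → Set} → IsPositive P → IsGraphRel P
positive⇒graphRel {P = P} (Y , T , factor) = record { sym = sym ; loop = loop }
  where
  open Equivalence
  sym : ∀ {x x'} → P x x' → P x' x
  sym {x} {x'} p with to (factor x x') p
  ... | y , tx , tx' = from (factor x' x) (y , tx' , tx)
  loop : ∀ {x x'} → P x x' → P x x
  loop {x} {x'} p with to (factor x x') p
  ... | y , tx , _ = from (factor x x) (y , tx , tx)

-- Conversely a graph relation is positive: factor it through its set of
-- edges, T relating a point to every edge it is an endpoint of.
graphRel⇒positive : {X : Set} {P : X → X → Set} → IsGraphRel P → IsPositive P
graphRel⇒positive {X} {P} graph = Edge , incident , λ x x' → mk⇔ (edgeOf x x') (endpoints x x')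
  where
  open IsGraphRel graph
  Edge : Set
  Edge = Σ X λ u → Σ X λ u' → P u u'
  incident : X → Edge → Set
  incident x (u , u' , _) = (x ≡ u) ⊎ (x ≡ u')
  edgeOf : ∀ x x' → P x x' → ∃ λ e → incident x e × incident x' e
  edgeOf x x' p = (x , x' , p) , inj₁ refl , inj₂ refl
  endpoints : ∀ x x' → (∃ λ e → incident x e × incident x' e) → P x x'
  endpoints x x' ((u , u' , p) , inj₁ refl , inj₁ refl) = loop p
  endpoints x x' ((u , u' , p) , inj₁ refl , inj₂ refl) = p
  endpoints x x' ((u , u' , p) , inj₂ refl , inj₁ refl) = sym p
  endpoints x x' ((u , u' , p) , inj₂ refl , inj₂ refl) = loop (sym p)

edgeRel : {A B : Set} → GHom A B → Rel4 A B
edgeRel γ a a' b b' = E γ a b a' b'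

loop⇔vertex : {A B : Set} (γ : GHom A B) {a : A} {b : B} → E γ a b a b ⇔ V γ a b
loop⇔vertex γ = mk⇔ (E-V γ) (V-E γ)

edgeRel-positive : {A B : Set} (γ : GHom A B) → IsPositive (bar (edgeRel γ))
edgeRel-positive γ = graphRel⇒positive record
  { sym  = λ { {_ , _} {_ , _} e → E-sym γ e }
  ; loop = λ { {_ , _} {_ , _} e → V-E γ (E-V γ (E-sym γ e)) }
  }

Φ : ∀ {A B : Set} → GHom A B → CPMHom A B
Φ γ = edgeRel γ , edgeRel-positive γ

Ψ : ∀ {A B : Set} → CPMHom A B → GHom A B
Ψ (R , positive) = record
  { V     = λ a b → R a a b b
  ; E     = λ a b a' b' → R a a' b b'
  ; E-sym = sym
  ; E-V   = λ e → loop (sym e)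
  ; V-E   = λ v → v
  }
  where open IsGraphRel (positive⇒graphRel positive)

≈C-refl : {A B : Set} {R : Rel4 A B} → R ≈C R
≈C-refl a a' b b' = ⇔-id _

theorem5p9 : Σ (∀ {A B : Set} → GHom A B → CPMHom A B) λ Φ →
               Σ (∀ {A B : Set} → CPMHom A B → GHom A B) λ Ψ →
                 IsStructIso Φ Ψ
theorem5p9 = Φ , Ψ , record
  { Φ-cong   = λ (_ , sameEdges) a a' b b' → sameEdges a b a' b'
  ; Ψ-cong   = λ same → (λ a b → same a a b b) , (λ a b a' b' → same a a' b b')
  ; ΦΨ       = λ _ → ≈C-refl
  ; ΨΦ       = λ γ → (λ a b → loop⇔vertex γ) , (λ a b a' b' → ⇔-id _)
  ; Φ-id     = λ _ → ≈C-refl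
  ; Φ-comp   = λ _ _ → ≈C-refl
  ; Φ-tensor = λ _ _ → ≈C-refl
  ; Φ-dagger = λ _ → ≈C-refl
  ; Φ-sym    = λ _ _ → ≈C-refl
  ; Φ-assoc  = λ _ _ _ → ≈C-refl
  ; Φ-lunit  = λ _ → ≈C-refl
  ; Φ-runit  = λ _ → ≈C-refl
  ; Φ-cup    = λ _ → ≈C-refl
  ; Φ-cap    = λ _ → ≈C-refl
  ; Φ-order  = λ _ _ → (λ le a a' b b' → le a b a' b') , (λ le a b a' b' → le a a' b b')
  ; Φ-join   = λ _ → ≈C-refl
  }
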